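{- For every integer $n\ge 0$, $$T_{n+2}=\sum_{k=1}^{n}P_{k+2}T_{n-k+2}+P_{n+3},$$ where $T_j$ are the tribonacci numbers and $P_j$ the Padovan numbers.
   Context: Tribonacci numbers: $T_0=T_1=0$, $T_2=1$, $T_n=T_{n-1}+T_{n-2}+T_{n-3}$ for $n\ge3$. Padovan sequence: $P_0=1$, $P_1=P_2=0$, $P_n=P_{n-2}+P_{n-3}$ for $n\ge3$. -}

module Defs where

open import Data.Nat using (ℕ; zero; suc; _+_; _*_; _∸_)

T : ℕ → ℕ
T 0 = 0
T 1 = 0
T 2 = 1
T (suc (suc (suc n))) = T (suc (suc n)) + T (suc n) + T n

P : ℕ → ℕ
P 0 = 1
P 1 = 0
P 2 = 0
P (suc (suc (suc n))) = P (suc n) + P n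

sum1to : ℕ → (ℕ → ℕ) → ℕ
sum1to zero f = 0
sum1to (suc m) f = sum1to m f + f (suc m)

-- Shift indices so that t j = T (j + 2) and p k = P (k + 2); the sum is then the
-- convolution C n = Σ_{k=1}^{n} p k · t (n - k).  Convolving any f with t gives a
-- sequence satisfying the tribonacci recurrence up to the single boundary term
-- f (n + 3), and for f = p the Padovan recurrence p (n + 4) = p (n + 2) + p (n + 1)
-- absorbs it: C n + p (n + 1) satisfies the tribonacci recurrence.  Both sides of the
-- identity therefore obey the same recurrence, and they agree for n = 0, 1, 2.
module Submission where

open import Defs
open import Data.Nat using (ℕ; zero; suc; _+_; _*_; _∸_; _≤_)
open import Data.Nat.Properties
  using (*-distribˡ-+; +-suc; +-∸-assoc; n∸n≡0; ≤-refl; m≤n⇒m≤1+n; +-commutativeSemigroup)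
open import Algebra.Properties.CommutativeSemigroup +-commutativeSemigroup using (interchange)
open import Data.Nat.Tactic.RingSolver using (solve-∀)
open import Function using (_∘_)
open import Relation.Binary.PropositionalEquality
  using (_≡_; refl; sym; trans; cong; cong₂; module ≡-Reasoning)

open ≡-Reasoning

sum1to-cong : ∀ m {f g : ℕ → ℕ} → (∀ k → k ≤ m → f k ≡ g k) → sum1to m f ≡ sum1to m g
sum1to-cong zero    f≗g = refl
sum1to-cong (suc m) f≗g =
  cong₂ _+_ (sum1to-cong m (λ k k≤m → f≗g k (m≤n⇒m≤1+n k≤m))) (f≗g (suc m) ≤-refl)

sum1to-+ : ∀ m (f g : ℕ → ℕ) → sum1to m (λ k → f k + g k) ≡ sum1to m f + sum1to m g
sum1to-+ zero    f g = refl
sum1to-+ (suc m) f g = begin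
  sum1to m (λ k → f k + g k) + (f (suc m) + g (suc m))
    ≡⟨ cong (_+ (f (suc m) + g (suc m))) (sum1to-+ m f g) ⟩
  sum1to m f + sum1to m g + (f (suc m) + g (suc m))
    ≡⟨ interchange (sum1to m f) (sum1to m g) (f (suc m)) (g (suc m)) ⟩
  sum1to m f + f (suc m) + (sum1to m g + g (suc m))
    ∎

-- Only the terms k = 1 … n occur; the k = 0 term of a full convolution is dropped.
conv : (ℕ → ℕ) → (ℕ → ℕ) → ℕ → ℕ
conv f g n = sum1to n (λ k → f k * g (n ∸ k))

conv-congʳ : ∀ f {g h : ℕ → ℕ} → (∀ j → g j ≡ h j) → ∀ n → conv f g n ≡ conv f h n
conv-congʳ f g≗h n = sum1to-cong n (λ k _ → cong (f k *_) (g≗h (n ∸ k)))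

conv-+ʳ : ∀ f g h n → conv f (λ j → g j + h j) n ≡ conv f g n + conv f h n
conv-+ʳ f g h n = trans
  (sum1to-cong n (λ k _ → *-distribˡ-+ (f k) (g (n ∸ k)) (h (n ∸ k))))
  (sum1to-+ n (λ k → f k * g (n ∸ k)) (λ k → f k * h (n ∸ k)))

conv-suc : ∀ f g n → conv f g (suc n) ≡ conv f (g ∘ suc) n + f (suc n) * g 0
conv-suc f g n = cong₂ _+_
  (sum1to-cong n (λ k k≤n → cong (λ j → f k * g j) (+-∸-assoc 1 k≤n)))
  (cong (λ j → f (suc n) * g j) (n∸n≡0 n))

TribonacciRecurrence : (ℕ → ℕ) → Set
TribonacciRecurrence u = ∀ n → u (3 + n) ≡ u (2 + n) + u (1 + n) + u n

tribonacci-unique : ∀ {u v} → TribonacciRecurrence u → TribonacciRecurrence v →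
  u 0 ≡ v 0 → u 1 ≡ v 1 → u 2 ≡ v 2 → ∀ n → u n ≡ v n
tribonacci-unique {u} {v} rec-u rec-v u0 u1 u2 = go
  where
  go : ∀ n → u n ≡ v n
  go 0 = u0
  go 1 = u1
  go 2 = u2
  go (suc (suc (suc n))) = begin
    u (3 + n)                     ≡⟨ rec-u n ⟩
    u (2 + n) + u (1 + n) + u n   ≡⟨ cong₂ _+_ (cong₂ _+_ (go (suc (suc n))) (go (suc n))) (go n) ⟩
    v (2 + n) + v (1 + n) + v n   ≡⟨ sym (rec-v n) ⟩
    v (3 + n)                     ∎

-- The hypotheses on g 1 and g 2 say that g extended by g (-1) = g (-2) = 0 still
-- satisfies the recurrence, which kills all boundary terms but f (n + 3) * g 0.
conv-tribonacci : ∀ f {g} → TribonacciRecurrence g → g 1 ≡ g 0 → g 2 ≡ g 1 + g 0 →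
  ∀ n → conv f g (3 + n) ≡ conv f g (2 + n) + conv f g (1 + n) + conv f g n + f (3 + n) * g 0
conv-tribonacci f {g} rec g1 g2 n = begin
  conv f g (3 + n)
    ≡⟨ unfold₃ ⟩
  X₃ + a * g 2 + b * g 1 + c * g 0
    ≡⟨ cong₂ (λ x y → X₃ + a * x + b * y + c * g 0) (trans g2 (cong (_+ g 0) g1)) g1 ⟩
  X₃ + a * (g 0 + g 0) + b * g 0 + c * g 0
    ≡⟨ cong (λ x → x + a * (g 0 + g 0) + b * g 0 + c * g 0) split₃ ⟩
  X₂ + X₁ + X₀ + a * (g 0 + g 0) + b * g 0 + c * g 0
    ≡⟨ regroup X₂ X₁ X₀ a b c (g 0) ⟩
  (X₂ + a * g 0 + b * g 0) + (X₁ + a * g 0) + X₀ + c * g 0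
    ≡⟨ cong (λ x → x + c * g 0) (cong₂ _+_ (cong₂ _+_ (sym unfold₂) (sym (conv-suc f g n))) refl) ⟩
  conv f g (2 + n) + conv f g (1 + n) + conv f g n + c * g 0
    ∎
  where
  a = f (1 + n)
  b = f (2 + n)
  c = f (3 + n)
  X₀ = conv f g n
  X₁ = conv f (g ∘ suc) n
  X₂ = conv f (g ∘ suc ∘ suc) n
  X₃ = conv f (g ∘ suc ∘ suc ∘ suc) n

  unfold₂ : conv f g (2 + n) ≡ X₂ + a * g 0 + b * g 0
  unfold₂ = begin
    conv f g (2 + n)                       ≡⟨ conv-suc f g (1 + n) ⟩
    conv f (g ∘ suc) (1 + n) + b * g 0     ≡⟨ cong (_+ b * g 0) (conv-suc f (g ∘ suc) n) ⟩
    X₂ + a * g 1 + b * g 0                 ≡⟨ cong (λ x → X₂ + a * x + b * g 0) g1 ⟩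
    X₂ + a * g 0 + b * g 0                 ∎

  unfold₃ : conv f g (3 + n) ≡ X₃ + a * g 2 + b * g 1 + c * g 0
  unfold₃ = begin
    conv f g (3 + n)                                 ≡⟨ conv-suc f g (2 + n) ⟩
    conv f (g ∘ suc) (2 + n) + c * g 0               ≡⟨ cong (_+ c * g 0) (conv-suc f (g ∘ suc) (1 + n)) ⟩
    conv f (g ∘ suc ∘ suc) (1 + n) + b * g 1 + c * g 0
      ≡⟨ cong (λ x → x + b * g 1 + c * g 0) (conv-suc f (g ∘ suc ∘ suc) n) ⟩
    X₃ + a * g 2 + b * g 1 + c * g 0                 ∎

  split₃ : X₃ ≡ X₂ + X₁ + X₀
  split₃ = trans (conv-congʳ f rec n)
    (trans (conv-+ʳ f (λ j → g (2 + j) + g (1 + j)) g n)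
           (cong (_+ X₀) (conv-+ʳ f (g ∘ suc ∘ suc) (g ∘ suc) n)))

  regroup : ∀ x₂ x₁ x₀ a b c z →
    x₂ + x₁ + x₀ + a * (z + z) + b * z + c * z ≡ (x₂ + a * z + b * z) + (x₁ + a * z) + x₀ + c * z
  regroup = solve-∀

tribonacci : ℕ → ℕ
tribonacci j = T (j + 2)

padovan : ℕ → ℕ
padovan k = P (k + 2)

tribonacci-recurrence : TribonacciRecurrence tribonacci
tribonacci-recurrence n = refl

padovan-recurrence : ∀ n → padovan (3 + n) ≡ padovan (1 + n) + padovan n
padovan-recurrence n = refl

padovan-convolution : ℕ → ℕ
padovan-convolution n = conv padovan tribonacci n + padovan (suc n)

padovan-convolution-recurrence : TribonacciRecurrence padovan-convolution
padovan-convolution-recurrence n = begin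
  C (3 + n) + padovan (4 + n)
    ≡⟨ cong₂ _+_ (conv-tribonacci padovan {tribonacci} tribonacci-recurrence refl refl n)
                 (padovan-recurrence (1 + n)) ⟩
  C (2 + n) + C (1 + n) + C n + padovan (3 + n) * 1 + (padovan (2 + n) + padovan (1 + n))
    ≡⟨ regroup (C (2 + n)) (C (1 + n)) (C n) (padovan (3 + n)) (padovan (2 + n)) (padovan (1 + n)) ⟩
  (C (2 + n) + padovan (3 + n)) + (C (1 + n) + padovan (2 + n)) + (C n + padovan (1 + n))
    ∎
  where
  C : ℕ → ℕ
  C = conv padovan tribonacci

  regroup : ∀ x₂ x₁ x₀ a b c →
    x₂ + x₁ + x₀ + a * 1 + (b + c) ≡ (x₂ + a) + (x₁ + b) + (x₀ + c)
  regroup = solve-∀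

theorem17 : (n : ℕ) →
    T (n + 2) ≡ sum1to n (λ k → P (k + 2) * T (n ∸ k + 2)) + P (n + 3)
theorem17 n = begin
  tribonacci n
    ≡⟨ tribonacci-unique {tribonacci} {padovan-convolution}
         tribonacci-recurrence padovan-convolution-recurrence refl refl refl n ⟩
  conv padovan tribonacci n + P (suc (n + 2))
    ≡⟨ cong (λ m → conv padovan tribonacci n + P m) (sym (+-suc n 2)) ⟩
  conv padovan tribonacci n + P (n + 3)
    ∎
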